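{- Let $d\ge 1$. Draw coupons independently and uniformly at random (with replacement) from $d$ types, and let $T$ be the first draw at which every one of the $d$ types has been obtained at least once. A type is a singleton if it has been obtained exactly once among the first $T$ draws; let $J$ be the number of singletons. Then for all integers $n\ge 1$ and $j\ge 1$, \[\Pr(T=n,\ J=j)=\frac{d!}{d^n}\binom{n-1}{j-1}\left\{ {n-j \atop d-j} \right\}_{\ge 2},\] where $\left\{ {m \atop k} \right\}_{\ge 2}$ denotes the number of partitions of an $m$-element set into $k$ unordered blocks each of size at least $2$ (value $1$ for $m=k=0$, and $0$ if $m<0$ or $k<0$). -}

module Defs where

open import Data.Bool using (Bool; true; _∧_; not)
open import Data.Nat using (ℕ; zero; suc; _∸_; _^_; _≡ᵇ_; _≤ᵇ_; NonZero)
open import Data.Nat.Properties using (m^n≢0)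
open import Data.Fin using (Fin)
open import Data.Fin.Properties using (_≟_)
open import Data.List using (List; []; _∷_; [_]; length; filterᵇ; allFin; map; concatMap; take; deduplicate)
open import Data.List.Properties using (≡-dec)
open import Data.Integer using (ℤ; +_; -[1+_])
open import Data.Rational using (ℚ; _/_)
open import Relation.Nullary.Decidable using (⌊_⌋)

all : ∀ {A : Set} → (A → Bool) → List A → Bool
all p []       = true
all p (x ∷ xs) = p x ∧ all p xs

draws : (d n : ℕ) → List (List (Fin d))
draws d zero    = [ [] ]
draws d (suc n) = concatMap (λ t → map (t ∷_) (draws d n)) (allFin d)

occ : ∀ {d} → Fin d → List (Fin d) → ℕ
occ t s = length (filterᵇ (λ x → ⌊ x ≟ t ⌋) s)

covers : ∀ d → List (Fin d) → Bool
covers d s = all (λ t → 1 ≤ᵇ occ t s) (allFin d)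

singletons : ∀ d → List (Fin d) → ℕ
singletons d s = length (filterᵇ (λ t → occ t s ≡ᵇ 1) (allFin d))

-- Event {T = n, J = j} evaluated on the first n draws s (it depends only on them):
-- all types are collected after n draws but not after n-1 draws (so T = n),
-- and the number of singletons among these T = n draws is j.
eventTJ : ∀ d (n j : ℕ) → List (Fin d) → Bool
eventTJ d n j s = covers d s ∧ not (covers d (take (n ∸ 1) s)) ∧ (singletons d s ≡ᵇ j)

probTJ : (d : ℕ) → .{{NonZero d}} → (n j : ℕ) → ℚ
probTJ d n j = (+ length (filterᵇ (eventTJ d n j) (draws d n))) / (d ^ n)
  where instance _ = m^n≢0 d n

-- Set partitions of an m-element set {0..m-1} into k unordered blocks are in
-- bijection with maps Fin m → Fin k (block labels) in which blocks are labelled in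
-- order of first appearance, i.e. the list of first occurrences is exactly 0,1,..,k-1.
-- A partition has all blocks of size ≥ 2 iff every label occurs at least twice.
isPartition≥2 : ∀ k → List (Fin k) → Bool
isPartition≥2 k s = ⌊ ≡-dec _≟_ (deduplicate _≟_ s) (allFin k) ⌋ ∧ all (λ t → 2 ≤ᵇ occ t s) (allFin k)

S≥2 : ℤ → ℤ → ℕ
S≥2 (+ m) (+ k) = length (filterᵇ (isPartition≥2 k) (draws k m))
S≥2 (+ m) -[1+ _ ] = 0
S≥2 -[1+ _ ] _ = 0

module Submission where

-- How a sequence of draws can continue depends only on its profile: the numbers of types not yet
-- seen, seen once, and seen at least twice.  The next draw falls into one of these classes with
-- multiplicity equal to the class size, so the number of continuations realising {T = n, J = j}
-- satisfies a linear recurrence on profiles.  The same is true for the restricted growth strings by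
-- which S≥2 is defined, except that there the only admissible new label is the next unused one.
-- To compare the two recurrences, introduce new types in a fixed order (this divides by d!) and
-- decide for each singleton whether it stays a singleton or is drawn again later.  Apart from the
-- last draw, the j - 1 surviving singletons occupy C(n-1, j-1) positions, and the remaining n - j
-- draws form a restricted growth string whose labels all occur at least twice.

open import Defs
open import Data.Nat using (ℕ; _∸_; _^_; _*_; _≥_; _!; NonZero)
open import Data.Nat.Properties using (m^n≢0)
open import Data.Nat.Combinatorics using (_C_)
open import Data.Integer using (+_; _-_)
open import Data.Rational using (ℚ; _/_)
open import Relation.Binary.PropositionalEquality using (_≡_)

open import Algebra.Properties.Semiring.Sum Data.Nat.Properties.+-*-semiring
  using (sum; sum-cong-≗; ∑-distrib-+; *-distribʳ-sum; sum-remove)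
open import Data.Bool using (Bool; true; false; _∧_; not)
open import Data.Fin using (Fin; zero; suc; punchIn; toℕ)
open import Data.Fin.Properties using (_≟_; punchInᵢ≢i; toℕ<n; toℕ-injective)
open import Data.Integer using (-[1+_]; -_; _⊖_)
open import Data.Integer.Properties using (⊖-≥; ⊖-<)
open import Data.List
  using (List; []; _∷_; [_]; _++_; _∷ʳ_; length; filter; filterᵇ; map; concatMap; tabulate; allFin; take;
         applyUpTo; upTo; deduplicate)
open import Data.List.Properties
  using (length-++; filter-++; filter-accept; filter-reject; ++-assoc; ++-identityʳ; map-++; map-tabulate;
         map-injective; ∷-injectiveˡ; ∷-injectiveʳ; upTo-∷ʳ; length-upTo; ≡-dec)
open import Data.Nat using (zero; suc; _+_; _≤_; _<_; z≤n; s≤s; _≡ᵇ_; _≤ᵇ_; _<ᵇ_)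
open import Data.Nat.Combinatorics using (k>n⇒nCk≡0; nCk+nC[k+1]≡[n+1]C[k+1])
open import Data.Nat.Properties
  using (+-assoc; +-comm; +-identityʳ; +-cancelʳ-≡; *-assoc; *-identityˡ; *-identityʳ; *-zeroʳ; *-distribʳ-+;
         m+n∸n≡m; +-∸-assoc; ∸-+-assoc; 0∸n≡0; n∸n≡0; m≤n⇒m∸n≡0; 0≢1+n; n≮n; ≤-reflexive; ≤-pred;
         <⇒≤; ≤∧≢⇒<; ≰⇒>; ≮⇒≥; _≤?_; _<?_)
  renaming (_≟_ to _≟ℕ_)
open import Data.Nat.Tactic.RingSolver using (solve-∀)
open import Data.Product using (_,_; ∃-syntax)
open import Function using (_∘_; _$_; id)
open import Relation.Binary.PropositionalEquality
  using (refl; sym; trans; cong; cong₂; subst; _≢_; module ≡-Reasoning)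
open import Relation.Nullary using (Dec; yes; no; ¬_; ¬?)
open import Relation.Nullary.Decidable using (⌊_⌋; dec-true; dec-false; isYes≗does)

𝟙 : Bool → ℕ
𝟙 true  = 1
𝟙 false = 0

isYes-true : ∀ {P : Set} (p? : Dec P) → P → ⌊ p? ⌋ ≡ true
isYes-true p? p = trans (isYes≗does p?) (dec-true p? p)

isYes-false : ∀ {P : Set} (p? : Dec P) → ¬ P → ⌊ p? ⌋ ≡ false
isYes-false p? ¬p = trans (isYes≗does p?) (dec-false p? ¬p)

count : ∀ {A : Set} → (A → Bool) → List A → ℕ
count P xs = length (filterᵇ P xs)

module _ {A : Set} (P : A → Bool) where

  count-∷ : ∀ x xs → count P (x ∷ xs) ≡ 𝟙 (P x) + count P xs
  count-∷ x xs with P x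
  ... | true  = refl
  ... | false = refl

  count-++ : ∀ xs ys → count P (xs ++ ys) ≡ count P xs + count P ys
  count-++ xs ys = trans (cong length (filter-++ _ xs ys)) (length-++ (filterᵇ P xs))

  count-tabulate : ∀ {n} (g : Fin n → A) → count P (tabulate g) ≡ sum (𝟙 ∘ P ∘ g)
  count-tabulate {zero}  g = refl
  count-tabulate {suc n} g =
    trans (count-∷ (g zero) _) (cong (_+_ (𝟙 (P (g zero)))) (count-tabulate (g ∘ suc)))

  count-concatMap-tabulate : ∀ {B : Set} {n} (f : B → List A) (g : Fin n → B) →
    count P (concatMap f (tabulate g)) ≡ sum (count P ∘ f ∘ g)
  count-concatMap-tabulate {n = zero}  f g = refl
  count-concatMap-tabulate {n = suc n} f g =
    trans (count-++ (f (g zero)) _) (cong (_+_ (count P (f (g zero)))) (count-concatMap-tabulate f (g ∘ suc)))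

count-[] : ∀ {A : Set} (P : List A → Bool) → count P [ [] ] ≡ 𝟙 (P [])
count-[] P = trans (count-∷ P [] []) (+-identityʳ _)

count-false : ∀ {A : Set} (xs : List A) → count (λ _ → false) xs ≡ 0
count-false []       = refl
count-false (x ∷ xs) = count-false xs

count-map : ∀ {A B : Set} (P : B → Bool) (f : A → B) xs → count P (map f xs) ≡ count (P ∘ f) xs
count-map P f []       = refl
count-map P f (x ∷ xs) with P (f x)
... | true  = cong suc (count-map P f xs)
... | false = count-map P f xs

count-cong : ∀ {A : Set} {P Q : A → Bool} → (∀ x → P x ≡ Q x) → ∀ xs → count P xs ≡ count Q xs
count-cong P≗Q []                   = refl
count-cong {P = P} {Q} P≗Q (x ∷ xs) = begin
  count P (x ∷ xs)      ≡⟨ count-∷ P x xs ⟩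
  𝟙 (P x) + count P xs  ≡⟨ cong₂ (λ β n → 𝟙 β + n) (P≗Q x) (count-cong P≗Q xs) ⟩
  𝟙 (Q x) + count Q xs  ≡⟨ count-∷ Q x xs ⟨
  count Q (x ∷ xs)      ∎
  where open ≡-Reasoning

all-tabulate : ∀ {A : Set} {n} (P : A → Bool) (g : Fin n → A) →
  all P (tabulate g) ≡ (sum (𝟙 ∘ not ∘ P ∘ g) ≡ᵇ 0)
all-tabulate {n = zero}  P g = refl
all-tabulate {n = suc n} P g with P (g zero)
... | true  = all-tabulate P (g ∘ suc)
... | false = refl

∑-const : ∀ n x → sum {n} (λ _ → x) ≡ n * x
∑-const zero    x = refl
∑-const (suc n) x = cong (_+_ x) (∑-const n x)

∑-update : ∀ {n} (h h′ : Fin n → ℕ) t → (∀ u → u ≢ t → h′ u ≡ h u) → sum h′ + h t ≡ sum h + h′ t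
∑-update {suc n} h h′ t agree = begin
  sum h′ + h t                       ≡⟨ cong (_+ h t) (sum-remove {i = t} h′) ⟩
  h′ t + sum (h′ ∘ punchIn t) + h t  ≡⟨ cong (λ s → h′ t + s + h t) (sum-cong-≗ (λ u → agree _ (punchInᵢ≢i t u))) ⟩
  h′ t + sum (h ∘ punchIn t) + h t   ≡⟨ swap (h′ t) _ (h t) ⟩
  h t + sum (h ∘ punchIn t) + h′ t   ≡⟨ cong (_+ h′ t) (sum-remove {i = t} h) ⟨
  sum h + h′ t                       ∎
  where
  open ≡-Reasoning
  swap : ∀ x s y → x + s + y ≡ y + s + x
  swap = solve-∀

count-extensions-suc : ∀ d m (Q : List (Fin d) → Bool) p →
  count (λ s → Q (p ++ s)) (draws d (suc m)) ≡ sum (λ t → count (λ s → Q ((p ∷ʳ t) ++ s)) (draws d m))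
count-extensions-suc d m Q p = begin
  count (λ s → Q (p ++ s)) (concatMap (λ t → map (t ∷_) (draws d m)) (tabulate id))
    ≡⟨ count-concatMap-tabulate _ (λ t → map (t ∷_) (draws d m)) id ⟩
  sum (λ t → count (λ s → Q (p ++ s)) (map (t ∷_) (draws d m)))
    ≡⟨ sum-cong-≗ (λ t → count-map _ (t ∷_) (draws d m)) ⟩
  sum (λ t → count (λ s → Q (p ++ t ∷ s)) (draws d m))
    ≡⟨ sum-cong-≗ (λ t → count-cong (λ s → cong Q (++-assoc p [ t ] s)) (draws d m)) ⟨
  sum (λ t → count (λ s → Q ((p ∷ʳ t) ++ s)) (draws d m))
    ∎
  where open ≡-Reasoning

-- Occurrence profiles

module _ {d : ℕ} where

  occ-∷-≡ : ∀ (x : Fin d) p → occ x (x ∷ p) ≡ suc (occ x p)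
  occ-∷-≡ x p = trans (count-∷ (λ y → ⌊ y ≟ x ⌋) x p) (cong (λ β → 𝟙 β + occ x p) (isYes-true (x ≟ x) refl))

  occ-∷-≢ : ∀ {x t : Fin d} p → x ≢ t → occ t (x ∷ p) ≡ occ t p
  occ-∷-≢ {x} {t} p x≢t =
    trans (count-∷ (λ y → ⌊ y ≟ t ⌋) x p) (cong (λ β → 𝟙 β + occ t p) (isYes-false (x ≟ t) x≢t))

  occ-∷ʳ : ∀ (u : Fin d) p t → occ u (p ∷ʳ t) ≡ occ u p + 𝟙 ⌊ t ≟ u ⌋
  occ-∷ʳ u p t =
    trans (count-++ _ p [ t ]) (cong (_+_ (occ u p)) (trans (count-∷ (λ x → ⌊ x ≟ u ⌋) t []) (+-identityʳ _)))

  occ-∷ʳ-self : ∀ p (t : Fin d) → occ t (p ∷ʳ t) ≡ suc (occ t p)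
  occ-∷ʳ-self p t = begin
    occ t (p ∷ʳ t)         ≡⟨ occ-∷ʳ t p t ⟩
    occ t p + 𝟙 ⌊ t ≟ t ⌋  ≡⟨ cong (λ β → occ t p + 𝟙 β) (isYes-true (t ≟ t) refl) ⟩
    occ t p + 1            ≡⟨ +-comm (occ t p) 1 ⟩
    suc (occ t p)          ∎
    where open ≡-Reasoning

  occ-∷ʳ-other : ∀ p {u t : Fin d} → u ≢ t → occ u (p ∷ʳ t) ≡ occ u p
  occ-∷ʳ-other p {u} {t} u≢t = begin
    occ u (p ∷ʳ t)         ≡⟨ occ-∷ʳ u p t ⟩
    occ u p + 𝟙 ⌊ t ≟ u ⌋  ≡⟨ cong (λ β → occ u p + 𝟙 β) (isYes-false (t ≟ u) (u≢t ∘ sym)) ⟩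
    occ u p + 0            ≡⟨ +-identityʳ _ ⟩
    occ u p                ∎
    where open ≡-Reasoning

  typesWith : (ℕ → Bool) → List (Fin d) → ℕ
  typesWith P p = sum (λ u → 𝟙 (P (occ u p)))

  typesWith-cong : ∀ {P Q : ℕ → Bool} → (∀ k → P k ≡ Q k) → ∀ p → typesWith P p ≡ typesWith Q p
  typesWith-cong P≗Q p = sum-cong-≗ (λ u → cong 𝟙 (P≗Q (occ u p)))

  typesWith-∷ʳ : ∀ P p t → typesWith P (p ∷ʳ t) + 𝟙 (P (occ t p)) ≡ typesWith P p + 𝟙 (P (suc (occ t p)))
  typesWith-∷ʳ P p t = begin
    typesWith P (p ∷ʳ t) + 𝟙 (P (occ t p))   ≡⟨ ∑-update _ _ t (λ u u≢t → cong (𝟙 ∘ P) (occ-∷ʳ-other p u≢t)) ⟩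
    typesWith P p + 𝟙 (P (occ t (p ∷ʳ t)))  ≡⟨ cong (λ k → typesWith P p + 𝟙 (P k)) (occ-∷ʳ-self p t) ⟩
    typesWith P p + 𝟙 (P (suc (occ t p)))   ∎
    where open ≡-Reasoning

record Profile : Set where
  constructor ⟨_,_,_⟩
  field
    unseen singles repeated : ℕ

open Profile

⟨,,⟩-cong : ∀ {a a′ b b′ c c′} → a ≡ a′ → b ≡ b′ → c ≡ c′ → ⟨ a , b , c ⟩ ≡ ⟨ a′ , b′ , c′ ⟩
⟨,,⟩-cong refl refl refl = refl

profile : ∀ {d} → List (Fin d) → Profile
profile p = ⟨ typesWith (_≡ᵇ 0) p , typesWith (_≡ᵇ 1) p , typesWith (2 ≤ᵇ_) p ⟩

afterDrawing : ℕ → Profile → Profile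
afterDrawing zero          ⟨ a , b , c ⟩ = ⟨ a ∸ 1 , suc b , c ⟩
afterDrawing (suc zero)    ⟨ a , b , c ⟩ = ⟨ a , b ∸ 1 , suc c ⟩
afterDrawing (suc (suc _)) π             = π

profile-∷ʳ : ∀ {d} (p : List (Fin d)) t → profile (p ∷ʳ t) ≡ afterDrawing (occ t p) (profile p)
profile-∷ʳ p t =
  byCount (occ t p) (typesWith-∷ʳ (_≡ᵇ 0) p t) (typesWith-∷ʳ (_≡ᵇ 1) p t) (typesWith-∷ʳ (2 ≤ᵇ_) p t)
  where
  lost : ∀ {x y} → x + 1 ≡ y + 0 → x ≡ y ∸ 1
  lost {x} {y} e = trans (sym (m+n∸n≡m x 1)) (cong (_∸ 1) (trans e (+-identityʳ y)))
  gained : ∀ {x y} → x + 0 ≡ y + 1 → x ≡ suc y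
  gained {x} {y} e = trans (sym (+-identityʳ x)) (trans e (+-comm y 1))
  kept : ∀ {x y} → x + 0 ≡ y + 0 → x ≡ y
  kept = +-cancelʳ-≡ 0 _ _
  byCount : ∀ k {a′ b′ c′ a b c} → a′ + 𝟙 (k ≡ᵇ 0) ≡ a + 𝟙 (suc k ≡ᵇ 0) → b′ + 𝟙 (k ≡ᵇ 1) ≡ b + 𝟙 (suc k ≡ᵇ 1) →
    c′ + 𝟙 (2 ≤ᵇ k) ≡ c + 𝟙 (2 ≤ᵇ suc k) → ⟨ a′ , b′ , c′ ⟩ ≡ afterDrawing k ⟨ a , b , c ⟩
  byCount zero          ea eb ec = ⟨,,⟩-cong (lost ea) (gained eb) (kept ec)
  byCount (suc zero)    ea eb ec = ⟨,,⟩-cong (kept ea) (lost eb) (gained ec)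
  byCount (suc (suc k)) ea eb ec = ⟨,,⟩-cong (kept ea) (kept eb) (+-cancelʳ-≡ 1 _ _ ec)

multiplicityCase : ∀ {A : Set} → ℕ → A → A → A → A
multiplicityCase zero          x y z = x
multiplicityCase (suc zero)    x y z = y
multiplicityCase (suc (suc _)) x y z = z

∑-multiplicityCase : ∀ {d} (p : List (Fin d)) (x : Fin d → ℕ) y z →
  sum (λ u → multiplicityCase (occ u p) (x u) y z)
    ≡ sum (λ u → 𝟙 (occ u p ≡ᵇ 0) * x u) + singles (profile p) * y + repeated (profile p) * z
∑-multiplicityCase p x y z = begin
  sum (λ u → multiplicityCase (occ u p) (x u) y z)
    ≡⟨ sum-cong-≗ (λ u → indicators (occ u p) (x u)) ⟩
  sum (λ u → X u + Y u + Z u)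
    ≡⟨ ∑-distrib-+ (λ u → X u + Y u) Z ⟩
  sum (λ u → X u + Y u) + sum Z
    ≡⟨ cong₂ _+_ (∑-distrib-+ X Y) (sym (*-distribʳ-sum z (λ u → 𝟙 (2 ≤ᵇ occ u p)))) ⟩
  sum X + sum Y + repeated (profile p) * z
    ≡⟨ cong (λ s → sum X + s + repeated (profile p) * z) (*-distribʳ-sum y (λ u → 𝟙 (occ u p ≡ᵇ 1))) ⟨
  sum X + singles (profile p) * y + repeated (profile p) * z
    ∎
  where
  open ≡-Reasoning
  X Y Z : Fin _ → ℕ
  X u = 𝟙 (occ u p ≡ᵇ 0) * x u
  Y u = 𝟙 (occ u p ≡ᵇ 1) * y
  Z u = 𝟙 (2 ≤ᵇ occ u p) * z
  only₁ : ∀ a b c → a ≡ 1 * a + 0 * b + 0 * c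
  only₁ = solve-∀
  only₂ : ∀ a b c → b ≡ 0 * a + 1 * b + 0 * c
  only₂ = solve-∀
  only₃ : ∀ a b c → c ≡ 0 * a + 0 * b + 1 * c
  only₃ = solve-∀
  indicators : ∀ k xu → multiplicityCase k xu y z ≡ 𝟙 (k ≡ᵇ 0) * xu + 𝟙 (k ≡ᵇ 1) * y + 𝟙 (2 ≤ᵇ k) * z
  indicators zero          xu = only₁ xu y z
  indicators (suc zero)    xu = only₂ xu y z
  indicators (suc (suc k)) xu = only₃ xu y z

drawStep : (Profile → ℕ) → Profile → ℕ
drawStep F π = unseen π * F (afterDrawing 0 π) + singles π * F (afterDrawing 1 π) + repeated π * F π

∑-profile-∷ʳ : ∀ {d} (F : Profile → ℕ) (p : List (Fin d)) →
  sum (λ t → F (profile (p ∷ʳ t))) ≡ drawStep F (profile p)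
∑-profile-∷ʳ F p = begin
  sum (λ t → F (profile (p ∷ʳ t)))
    ≡⟨ sum-cong-≗ (λ t → trans (cong F (profile-∷ʳ p t)) (byMultiplicity (occ t p))) ⟩
  sum (λ t → multiplicityCase (occ t p) (F (afterDrawing 0 π)) (F (afterDrawing 1 π)) (F π))
    ≡⟨ ∑-multiplicityCase p _ _ _ ⟩
  sum (λ t → 𝟙 (occ t p ≡ᵇ 0) * F (afterDrawing 0 π)) + singles π * F (afterDrawing 1 π) + repeated π * F π
    ≡⟨ cong (λ s → s + singles π * F (afterDrawing 1 π) + repeated π * F π)
            (*-distribʳ-sum (F (afterDrawing 0 π)) (λ t → 𝟙 (occ t p ≡ᵇ 0))) ⟨
  drawStep F π
    ∎
  where
  open ≡-Reasoning
  π = profile p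
  byMultiplicity : ∀ k →
    F (afterDrawing k π) ≡ multiplicityCase k (F (afterDrawing 0 π)) (F (afterDrawing 1 π)) (F π)
  byMultiplicity zero          = refl
  byMultiplicity (suc zero)    = refl
  byMultiplicity (suc (suc k)) = refl

module _ {d : ℕ} where

  profile-[] : profile {d} [] ≡ ⟨ d , 0 , 0 ⟩
  profile-[] =
    ⟨,,⟩-cong (trans (∑-const d 1) (*-identityʳ d)) (trans (∑-const d 0) (*-zeroʳ d))
              (trans (∑-const d 0) (*-zeroʳ d))

  covers-unseen : ∀ (p : List (Fin d)) → covers d p ≡ (unseen (profile p) ≡ᵇ 0)
  covers-unseen p =
    trans (all-tabulate (λ t → 1 ≤ᵇ occ t p) (id {A = Fin d})) (cong (_≡ᵇ 0) (typesWith-cong absent p))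
    where
    absent : ∀ k → not (1 ≤ᵇ k) ≡ (k ≡ᵇ 0)
    absent zero    = refl
    absent (suc k) = refl

  singletons-singles : ∀ (p : List (Fin d)) → singletons d p ≡ singles (profile p)
  singletons-singles p = count-tabulate (λ t → occ t p ≡ᵇ 1) (id {A = Fin d})

-- Completing the collection

take-length-++ : ∀ {A : Set} (p q : List A) → take (length p) (p ++ q) ≡ p
take-length-++ []      q = refl
take-length-++ (x ∷ p) q = cong (x ∷_) (take-length-++ p q)

completions : ℕ → ℕ → Profile → ℕ
completions J zero    ⟨ a , b , c ⟩ = a * 𝟙 ((a ≡ᵇ 1) ∧ (b ≡ᵇ J))
completions J (suc m) π             = drawStep (completions J m) π

module _ {d : ℕ} (J : ℕ) where

  completes : Profile → Profile → Bool
  completes before after = (unseen after ≡ᵇ 0) ∧ not (unseen before ≡ᵇ 0) ∧ (singles after ≡ᵇ suc J)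

  eventTJ-∷ʳ : ∀ (p : List (Fin d)) t →
    eventTJ d (length p + 1) (suc J) (p ∷ʳ t) ≡ completes (profile p) (profile (p ∷ʳ t))
  eventTJ-∷ʳ p t
    rewrite m+n∸n≡m (length p) 1 | take-length-++ p [ t ]
          | covers-unseen (p ∷ʳ t) | covers-unseen p | singletons-singles (p ∷ʳ t) = refl

  drawStep-completes : ∀ a b c →
    drawStep (𝟙 ∘ completes ⟨ a , b , c ⟩) ⟨ a , b , c ⟩ ≡ completions J 0 ⟨ a , b , c ⟩
  drawStep-completes zero    b c = cong₂ _+_ (*-zeroʳ b) (*-zeroʳ c)
  drawStep-completes (suc a) b c = dropZeros (suc a * 𝟙 ((a ≡ᵇ 0) ∧ (b ≡ᵇ J))) b c
    where
    dropZeros : ∀ x y z → x + y * 0 + z * 0 ≡ x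
    dropZeros = solve-∀

  count-completions : ∀ n m (p : List (Fin d)) → length p + suc m ≡ n →
    count (λ s → eventTJ d n (suc J) (p ++ s)) (draws d (suc m)) ≡ completions J m (profile p)
  count-completions n zero p refl = begin
    count (λ s → E (p ++ s)) (draws d 1)                    ≡⟨ count-extensions-suc d 0 E p ⟩
    sum (λ t → count (λ s → E ((p ∷ʳ t) ++ s)) [ [] ])      ≡⟨ sum-cong-≗ lastDraw ⟩
    sum (λ t → 𝟙 (completes (profile p) (profile (p ∷ʳ t))))  ≡⟨ ∑-profile-∷ʳ (𝟙 ∘ completes (profile p)) p ⟩
    drawStep (𝟙 ∘ completes (profile p)) (profile p)        ≡⟨ drawStep-completes a b c ⟩
    completions J 0 (profile p)                             ∎
    where
    open ≡-Reasoning
    E = eventTJ d n (suc J)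
    a = unseen (profile p)
    b = singles (profile p)
    c = repeated (profile p)
    lastDraw : ∀ t → count (λ s → E ((p ∷ʳ t) ++ s)) [ [] ] ≡ 𝟙 (completes (profile p) (profile (p ∷ʳ t)))
    lastDraw t = begin
      count (λ s → E ((p ∷ʳ t) ++ s)) [ [] ]          ≡⟨ count-[] (λ s → E ((p ∷ʳ t) ++ s)) ⟩
      𝟙 (E ((p ∷ʳ t) ++ []))                          ≡⟨ cong (𝟙 ∘ E) (++-identityʳ (p ∷ʳ t)) ⟩
      𝟙 (E (p ∷ʳ t))                                  ≡⟨ cong 𝟙 (eventTJ-∷ʳ p t) ⟩
      𝟙 (completes (profile p) (profile (p ∷ʳ t)))    ∎
  count-completions n (suc m) p len = begin
    count (λ s → E (p ++ s)) (draws d (suc (suc m)))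
      ≡⟨ count-extensions-suc d (suc m) E p ⟩
    sum (λ t → count (λ s → E ((p ∷ʳ t) ++ s)) (draws d (suc m)))
      ≡⟨ sum-cong-≗ (λ t → count-completions n m (p ∷ʳ t) (len′ t)) ⟩
    sum (λ t → completions J m (profile (p ∷ʳ t)))
      ≡⟨ ∑-profile-∷ʳ (completions J m) p ⟩
    completions J (suc m) (profile p)
      ∎
    where
    open ≡-Reasoning
    E = eventTJ d n (suc J)
    len′ : ∀ t → length (p ∷ʳ t) + suc m ≡ n
    len′ t = trans (cong (_+ suc m) (length-++ p)) (trans (+-assoc (length p) 1 (suc m)) len)

-- In splitCount m a r B b c and rgsCount m a b c new types are introduced in a fixed order, a - 1 of
-- them are still to come (a = 0 is a dead state), B singletons are undecided, b singletons are marked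
-- to be drawn again and c types have been drawn at least twice; exactly r undecided singletons must
-- survive the m draws.
splitCount : ℕ → ℕ → ℕ → ℕ → ℕ → ℕ → ℕ
splitCount zero    a r B b c = 𝟙 ((a ≡ᵇ 1) ∧ (b ≡ᵇ 0) ∧ (B ≡ᵇ r))
splitCount (suc m) a r B b c =
  splitCount m (a ∸ 1) r (suc B) b c + B * splitCount m a r (B ∸ 1) b (suc c)
  + b * splitCount m a r B (b ∸ 1) (suc c) + c * splitCount m a r B b c

splitCount⁻ : ℕ → ℕ → ℕ → ℕ → ℕ → ℕ → ℕ
splitCount⁻ m a zero    B b c = 0
splitCount⁻ m a (suc r) B b c = splitCount m a r B b c

rgsCount : ℕ → ℕ → ℕ → ℕ → ℕ
rgsCount zero    a b c = 𝟙 ((a ≡ᵇ 1) ∧ (b ≡ᵇ 0))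
rgsCount (suc m) a b c = rgsCount m (a ∸ 1) (suc b) c + b * rgsCount m a (b ∸ 1) (suc c) + c * rgsCount m a b c

splitCount-dead : ∀ m r B b c → splitCount m 0 r B b c ≡ 0
splitCount-dead zero    r B b c = refl
splitCount-dead (suc m) r B b c
  rewrite splitCount-dead m r (suc B) b c | splitCount-dead m r (B ∸ 1) b (suc c)
        | splitCount-dead m r B (b ∸ 1) (suc c) | splitCount-dead m r B b c
        | *-zeroʳ B | *-zeroʳ b | *-zeroʳ c = refl

rgsCount-dead : ∀ m b c → rgsCount m 0 b c ≡ 0
rgsCount-dead zero    b c = refl
rgsCount-dead (suc m) b c
  rewrite rgsCount-dead m (suc b) c | rgsCount-dead m (b ∸ 1) (suc c) | rgsCount-dead m b c
        | *-zeroʳ b | *-zeroʳ c = refl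

completions-splitCount : ∀ J m a B c → completions J m ⟨ a , B , c ⟩ ≡ a ! * splitCount m a J B 0 c
completions-splitCount J zero    zero                B c = refl
completions-splitCount J zero    (suc zero)          B c = refl
completions-splitCount J zero    a@(suc (suc _))     B c = trans (*-zeroʳ a) (sym (*-zeroʳ (a !)))
completions-splitCount J (suc m) a B c
  rewrite completions-splitCount J m (a ∸ 1) (suc B) c | completions-splitCount J m a (B ∸ 1) (suc c)
        | completions-splitCount J m a B c
  = trans (cong (λ x → x + B * (a ! * S₂) + c * (a ! * S₃)) (newType a))
          (factor (a !) S₁ B S₂ S₃ c (splitCount m a J B 0 (suc c)))
  where
  S₁ = splitCount m (a ∸ 1) J (suc B) 0 c
  S₂ = splitCount m a J (B ∸ 1) 0 (suc c)
  S₃ = splitCount m a J B 0 c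
  newType : ∀ a → a * ((a ∸ 1) ! * splitCount m (a ∸ 1) J (suc B) 0 c)
                     ≡ a ! * splitCount m (a ∸ 1) J (suc B) 0 c
  newType zero    = sym (trans (*-identityˡ _) (splitCount-dead m J (suc B) 0 c))
  newType (suc a) = sym (*-assoc (suc a) (a !) _)
  factor : ∀ f x B y z c w → f * x + B * (f * y) + c * (f * z) ≡ f * (x + B * y + 0 * w + c * z)
  factor = solve-∀

*-pred-cong : ∀ n {f g : ℕ → ℕ} → (∀ k → f (suc k) ≡ g k) → n * f n ≡ n * g (n ∸ 1)
*-pred-cong zero    eq = refl
*-pred-cong (suc n) eq = cong (suc n *_) (eq n)

splitCount⁻-suc : ∀ m a r B b c → splitCount⁻ (suc m) a r B b c ≡
  splitCount⁻ m (a ∸ 1) r (suc B) b c + B * splitCount⁻ m a r (B ∸ 1) b (suc c)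
  + b * splitCount⁻ m a r B (b ∸ 1) (suc c) + c * splitCount⁻ m a r B b c
splitCount⁻-suc m a zero    B b c rewrite *-zeroʳ B | *-zeroʳ b | *-zeroʳ c = refl
splitCount⁻-suc m a (suc r) B b c = refl

splitCount-decide : ∀ m a r B b c →
  splitCount m a r (suc B) b c ≡ splitCount⁻ m a r B b c + splitCount m a r B (suc b) c
splitCount-decide zero a zero B b c with a ≡ᵇ 1 | b ≡ᵇ 0
... | false | _     = refl
... | true  | false = refl
... | true  | true  = refl
splitCount-decide zero a (suc r) B b c with a ≡ᵇ 1 | b ≡ᵇ 0
... | false | _     = refl
... | true  | false = refl
... | true  | true  = sym (+-identityʳ _)
splitCount-decide (suc m) a r B b c = begin
  S₁ + suc B * X + b * S₃ + c * S₄
    ≡⟨ cong (λ s → s + suc B * X + b * S₃ + c * S₄) (splitCount-decide m (a ∸ 1) r (suc B) b c) ⟩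
  (P₁ + H₁) + suc B * X + b * S₃ + c * S₄
    ≡⟨ cong₂ (λ s s′ → (P₁ + H₁) + suc B * X + b * s + c * s′)
             (splitCount-decide m a r B (b ∸ 1) (suc c)) (splitCount-decide m a r B b c) ⟩
  (P₁ + H₁) + suc B * X + b * (P₃ + H₃) + c * (P₄ + H₄)
    ≡⟨ expand P₁ H₁ B X b P₃ H₃ c P₄ H₄ ⟩
  P₁ + H₁ + X + B * X + b * P₃ + b * H₃ + c * (P₄ + H₄)
    ≡⟨ cong₂ (λ u v → P₁ + H₁ + X + u + b * P₃ + v + c * (P₄ + H₄))
             (*-pred-cong B {f = λ k → splitCount m a r k b (suc c)}
                            (λ k → splitCount-decide m a r k b (suc c)))
             (sym (*-pred-cong b {f = λ k → splitCount m a r B k (suc c)}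
                                 {g = λ k → splitCount m a r B (suc k) (suc c)} (λ _ → refl))) ⟩
  P₁ + H₁ + X + B * (P₂ + H₂) + b * P₃ + b * X + c * (P₄ + H₄)
    ≡⟨ collect P₁ H₁ B X b P₃ c P₄ H₄ P₂ H₂ ⟩
  (P₁ + B * P₂ + b * P₃ + c * P₄) + (H₁ + B * H₂ + suc b * X + c * H₄)
    ≡⟨ cong (_+ (H₁ + B * H₂ + suc b * X + c * H₄)) (splitCount⁻-suc m a r B b c) ⟨
  splitCount⁻ (suc m) a r B b c + splitCount (suc m) a r B (suc b) c
    ∎
  where
  open ≡-Reasoning
  X  = splitCount m a r B b (suc c)
  S₁ = splitCount m (a ∸ 1) r (suc (suc B)) b c
  S₃ = splitCount m a r (suc B) (b ∸ 1) (suc c)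
  S₄ = splitCount m a r (suc B) b c
  P₁ = splitCount⁻ m (a ∸ 1) r (suc B) b c
  P₂ = splitCount⁻ m a r (B ∸ 1) b (suc c)
  P₃ = splitCount⁻ m a r B (b ∸ 1) (suc c)
  P₄ = splitCount⁻ m a r B b c
  H₁ = splitCount m (a ∸ 1) r (suc B) (suc b) c
  H₂ = splitCount m a r (B ∸ 1) (suc b) (suc c)
  H₃ = splitCount m a r B (suc (b ∸ 1)) (suc c)
  H₄ = splitCount m a r B (suc b) c
  expand : ∀ P₁ H₁ B X b P₃ H₃ c P₄ H₄ →
    (P₁ + H₁) + suc B * X + b * (P₃ + H₃) + c * (P₄ + H₄)
      ≡ P₁ + H₁ + X + B * X + b * P₃ + b * H₃ + c * (P₄ + H₄)
  expand = solve-∀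
  collect : ∀ P₁ H₁ B X b P₃ c P₄ H₄ P₂ H₂ →
    P₁ + H₁ + X + B * (P₂ + H₂) + b * P₃ + b * X + c * (P₄ + H₄)
      ≡ (P₁ + B * P₂ + b * P₃ + c * P₄) + (H₁ + B * H₂ + suc b * X + c * H₄)
  collect = solve-∀

C*-∸-suc : ∀ m r (f : ℕ → ℕ) → (m C suc r) * f (suc (m ∸ suc r)) ≡ (m C suc r) * f (m ∸ r)
C*-∸-suc m r f with suc r ≤? m
... | yes r<m = cong (λ k → (m C suc r) * f k) (sym (+-∸-assoc 1 r<m))
... | no  r≮m = trans (cong (_* f (suc (m ∸ suc r))) C≡0) (sym (cong (_* f (m ∸ r)) C≡0))
  where C≡0 = k>n⇒nCk≡0 (≰⇒> r≮m)

∸-1-comm : ∀ a r → a ∸ 1 ∸ r ≡ a ∸ r ∸ 1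
∸-1-comm a r = trans (∸-+-assoc a 1 r) (trans (cong (a ∸_) (+-comm 1 r)) (sym (∸-+-assoc a r 1)))

splitCount-rgsCount : ∀ m a r b c → splitCount m a r 0 b c ≡ (m C r) * rgsCount (m ∸ r) (a ∸ r) b c
splitCount-rgsCount zero a zero b c with a ≡ᵇ 1 | b ≡ᵇ 0
... | false | _     = refl
... | true  | false = refl
... | true  | true  = refl
splitCount-rgsCount zero a (suc r) b c with a ≡ᵇ 1 | b ≡ᵇ 0
... | false | _     = refl
... | true  | false = refl
... | true  | true  = refl
splitCount-rgsCount (suc m) a zero b c
  rewrite splitCount-decide m (a ∸ 1) 0 0 b c | splitCount-rgsCount m (a ∸ 1) 0 (suc b) c
        | splitCount-rgsCount m a 0 (b ∸ 1) (suc c) | splitCount-rgsCount m a 0 b c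
  = regroup (rgsCount m (a ∸ 1) (suc b) c) (rgsCount m a (b ∸ 1) (suc c)) (rgsCount m a b c) b c
  where
  regroup : ∀ R₁ R₂ R₃ b c → 0 + 1 * R₁ + 0 + b * (1 * R₂) + c * (1 * R₃) ≡ 1 * (R₁ + b * R₂ + c * R₃)
  regroup = solve-∀
splitCount-rgsCount (suc m) a (suc r) b c
  rewrite splitCount-decide m (a ∸ 1) (suc r) 0 b c
        | splitCount-rgsCount m (a ∸ 1) r b c | splitCount-rgsCount m (a ∸ 1) (suc r) (suc b) c
        | splitCount-rgsCount m a (suc r) (b ∸ 1) (suc c) | splitCount-rgsCount m a (suc r) b c
        | ∸-+-assoc a 1 r | ∸-1-comm a (suc r)
  = begin
    C₀ * R₀ + C₁ * R₁ + 0 + b * (C₁ * R₂) + c * (C₁ * R₃)  ≡⟨ regroup C₀ R₀ C₁ R₁ b R₂ c R₃ ⟩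
    C₀ * R₀ + C₁ * rgsCount (suc (m ∸ suc r)) x b c
      ≡⟨ cong (_+_ (C₀ * R₀)) (C*-∸-suc m r (λ k → rgsCount k x b c)) ⟩
    C₀ * R₀ + C₁ * R₀                                      ≡⟨ *-distribʳ-+ R₀ C₀ C₁ ⟨
    (C₀ + C₁) * R₀                                         ≡⟨ cong (_* R₀) (nCk+nC[k+1]≡[n+1]C[k+1] m r) ⟩
    (suc m C suc r) * R₀                                   ∎
  where
  open ≡-Reasoning
  x  = a ∸ suc r
  C₀ = m C r
  C₁ = m C suc r
  R₀ = rgsCount (m ∸ r) x b c
  R₁ = rgsCount (m ∸ suc r) (x ∸ 1) (suc b) c
  R₂ = rgsCount (m ∸ suc r) x (b ∸ 1) (suc c)
  R₃ = rgsCount (m ∸ suc r) x b c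
  regroup : ∀ C₀ R₀ C₁ R₁ b R₂ c R₃ →
    C₀ * R₀ + C₁ * R₁ + 0 + b * (C₁ * R₂) + c * (C₁ * R₃) ≡ C₀ * R₀ + C₁ * (R₁ + b * R₂ + c * R₃)
  regroup = solve-∀

-- Restricted growth strings

tabulate-toℕ : ∀ {A : Set} n (f : ℕ → A) → tabulate (λ (i : Fin n) → f (toℕ i)) ≡ applyUpTo f n
tabulate-toℕ zero    f = refl
tabulate-toℕ (suc n) f = cong (f 0 ∷_) (tabulate-toℕ n (f ∘ suc))

map-toℕ-allFin : ∀ n → map toℕ (allFin n) ≡ upTo n
map-toℕ-allFin n = trans (map-tabulate id toℕ) (tabulate-toℕ n id)

applyUpTo-++-∷ : ∀ {A : Set} (f : ℕ → A) L n v ys → applyUpTo f L ++ v ∷ ys ≡ applyUpTo f n → v ≡ f L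
applyUpTo-++-∷ f zero    (suc n) v ys eq = ∷-injectiveˡ eq
applyUpTo-++-∷ f (suc L) (suc n) v ys eq = applyUpTo-++-∷ (f ∘ suc) L n v ys (∷-injectiveʳ eq)

≤ᵇ-≢-suc : ∀ L x → x ≢ L → (L ≤ᵇ x) ≡ (suc L ≤ᵇ x)
≤ᵇ-≢-suc L x x≢L with L ≤? x
... | yes L≤x = trans (dec-true (L ≤? x) L≤x) (sym (dec-true (suc L ≤? x) (≤∧≢⇒< L≤x (x≢L ∘ sym))))
... | no  L≰x = trans (dec-false (L ≤? x) L≰x) (sym (dec-false (suc L ≤? x) (L≰x ∘ <⇒≤)))

∑-toℕ≡ : ∀ n L → sum {n} (λ u → 𝟙 (toℕ u ≡ᵇ L)) ≡ 𝟙 (L <ᵇ n)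
∑-toℕ≡ zero    L       = refl
∑-toℕ≡ (suc n) zero    = cong suc (trans (∑-const n 0) (*-zeroʳ n))
∑-toℕ≡ (suc n) (suc L) = ∑-toℕ≡ n L

∑-≤toℕ : ∀ n L → sum {n} (λ u → 𝟙 (L ≤ᵇ toℕ u)) ≡ n ∸ L
∑-≤toℕ zero    L       = sym (0∸n≡0 L)
∑-≤toℕ (suc n) zero    = cong suc (trans (∑-const n 1) (*-identityʳ n))
∑-≤toℕ (suc n) (suc L) = trans (sum-cong-≗ {n} (λ u → cong 𝟙 (suc-≤ᵇ L (toℕ u)))) (∑-≤toℕ n L)
  where
  suc-≤ᵇ : ∀ a b → (suc a ≤ᵇ suc b) ≡ (a ≤ᵇ b)
  suc-≤ᵇ zero    b = refl
  suc-≤ᵇ (suc a) b = refl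

𝟙<ᵇ*rgsCount : ∀ m K L b c → 𝟙 (L <ᵇ K) * rgsCount m (K ∸ L) b c ≡ rgsCount m (K ∸ L) b c
𝟙<ᵇ*rgsCount m K L b c with L <? K
... | yes L<K = trans (cong (λ β → 𝟙 β * rgsCount m (K ∸ L) b c) (dec-true (L <? K) L<K)) (*-identityˡ _)
... | no  L≮K = begin
  𝟙 (L <ᵇ K) * rgsCount m (K ∸ L) b c  ≡⟨ cong (λ β → 𝟙 β * rgsCount m (K ∸ L) b c) (dec-false (L <? K) L≮K) ⟩
  0                                    ≡⟨ rgsCount-dead m b c ⟨
  rgsCount m 0 b c                     ≡⟨ cong (λ a → rgsCount m a b c) (m≤n⇒m∸n≡0 (≮⇒≥ L≮K)) ⟨
  rgsCount m (K ∸ L) b c               ∎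
  where open ≡-Reasoning

module _ {K : ℕ} where

  dedup : List (Fin K) → List (Fin K)
  dedup = deduplicate _≟_

  dedup-++ : ∀ q s → ∃[ X ] dedup (q ++ s) ≡ dedup q ++ X
  dedup-++ []      s = dedup s , refl
  dedup-++ (x ∷ q) s with X , eq ← dedup-++ q s =
    filter x≢? X , cong (x ∷_) (trans (cong (filter x≢?) eq) (filter-++ x≢? (dedup q) X))
    where x≢? = ¬? ∘ (x ≟_)

  dedup-∷ʳ-new : ∀ p t → occ t p ≡ 0 → dedup (p ∷ʳ t) ≡ dedup p ∷ʳ t
  dedup-∷ʳ-new []      t _   = refl
  dedup-∷ʳ-new (x ∷ p) t new = cong (x ∷_) (begin
    filter x≢? (dedup (p ∷ʳ t))               ≡⟨ cong (filter x≢?) (dedup-∷ʳ-new p t new′) ⟩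
    filter x≢? (dedup p ∷ʳ t)                 ≡⟨ filter-++ x≢? (dedup p) [ t ] ⟩
    filter x≢? (dedup p) ++ filter x≢? [ t ]  ≡⟨ cong (filter x≢? (dedup p) ++_) (filter-accept x≢? x≢t) ⟩
    filter x≢? (dedup p) ∷ʳ t                 ∎)
    where
    open ≡-Reasoning
    x≢? = ¬? ∘ (x ≟_)
    x≢t : x ≢ t
    x≢t refl = 0≢1+n (trans (sym new) (occ-∷-≡ x p))
    new′ = trans (sym (occ-∷-≢ p x≢t)) new

  dedup-∷ʳ-seen : ∀ p t {k} → occ t p ≡ suc k → dedup (p ∷ʳ t) ≡ dedup p
  dedup-∷ʳ-seen []      t ()
  dedup-∷ʳ-seen (x ∷ p) t seen = cong (x ∷_) (byCase (x ≟ t))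
    where
    open ≡-Reasoning
    x≢? = ¬? ∘ (x ≟_)
    lastDropped : ∀ n → occ x p ≡ n → filter x≢? (dedup (p ∷ʳ x)) ≡ filter x≢? (dedup p)
    lastDropped zero new = begin
      filter x≢? (dedup (p ∷ʳ x))               ≡⟨ cong (filter x≢?) (dedup-∷ʳ-new p x new) ⟩
      filter x≢? (dedup p ∷ʳ x)                 ≡⟨ filter-++ x≢? (dedup p) [ x ] ⟩
      filter x≢? (dedup p) ++ filter x≢? [ x ]  ≡⟨ cong (filter x≢? (dedup p) ++_) (filter-reject x≢? (_$ refl)) ⟩
      filter x≢? (dedup p) ++ []                ≡⟨ ++-identityʳ _ ⟩
      filter x≢? (dedup p)                      ∎
    lastDropped (suc n) old = cong (filter x≢?) (dedup-∷ʳ-seen p x old)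
    byCase : Dec (x ≡ t) → filter x≢? (dedup (p ∷ʳ t)) ≡ filter x≢? (dedup p)
    byCase (yes refl) = lastDropped (occ x p) refl
    byCase (no x≢t)   = cong (filter x≢?) (dedup-∷ʳ-seen p t (trans (sym (occ-∷-≢ p x≢t)) seen))

  record RGSPrefix (p : List (Fin K)) (L : ℕ) : Set where
    field
      bound  : L ≤ K
      firsts : map toℕ (dedup p) ≡ upTo L
      unused : ∀ u → (occ u p ≡ᵇ 0) ≡ (L ≤ᵇ toℕ u)

  open RGSPrefix

  rgs-[] : RGSPrefix [] 0
  rgs-[] = record { bound = z≤n ; firsts = refl ; unused = λ _ → refl }

  rgs-seen : ∀ {p L} → RGSPrefix p L → ∀ t {k} → occ t p ≡ suc k → RGSPrefix (p ∷ʳ t) L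
  bound  (rgs-seen inv t seen)     = bound inv
  firsts (rgs-seen {p} inv t seen) = trans (cong (map toℕ) (dedup-∷ʳ-seen p t seen)) (firsts inv)
  unused (rgs-seen {p} inv t seen) u with u ≟ t
  ... | yes refl = trans (cong (_≡ᵇ 0) (occ-∷ʳ-self p t)) (trans (sym (cong (_≡ᵇ 0) seen)) (unused inv t))
  ... | no  u≢t  = trans (cong (_≡ᵇ 0) (occ-∷ʳ-other p u≢t)) (unused inv u)

  rgs-new : ∀ {p L} → RGSPrefix p L → ∀ t → occ t p ≡ 0 → toℕ t ≡ L → RGSPrefix (p ∷ʳ t) (suc L)
  bound  (rgs-new inv t new refl)     = toℕ<n t
  firsts (rgs-new {p} inv t new refl) = begin
    map toℕ (dedup (p ∷ʳ t))    ≡⟨ cong (map toℕ) (dedup-∷ʳ-new p t new) ⟩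
    map toℕ (dedup p ∷ʳ t)      ≡⟨ map-++ toℕ (dedup p) [ t ] ⟩
    map toℕ (dedup p) ∷ʳ toℕ t  ≡⟨ cong (_∷ʳ toℕ t) (firsts inv) ⟩
    upTo (toℕ t) ∷ʳ toℕ t       ≡⟨ upTo-∷ʳ (toℕ t) ⟩
    upTo (suc (toℕ t))          ∎
    where open ≡-Reasoning
  unused (rgs-new {p} inv t new refl) u with u ≟ t
  ... | yes refl = trans (cong (_≡ᵇ 0) (occ-∷ʳ-self p t)) (sym (dec-false (suc (toℕ t) ≤? toℕ t) (n≮n (toℕ t))))
  ... | no  u≢t  = trans (cong (_≡ᵇ 0) (occ-∷ʳ-other p u≢t))
                         (trans (unused inv u) (≤ᵇ-≢-suc (toℕ t) (toℕ u) (u≢t ∘ toℕ-injective)))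

  rgs-skip : ∀ {p L} → RGSPrefix p L → ∀ t → occ t p ≡ 0 → toℕ t ≢ L → ∀ s →
    isPartition≥2 K ((p ∷ʳ t) ++ s) ≡ false
  rgs-skip {p} {L} inv t new t≢L s with X , eq ← dedup-++ (p ∷ʳ t) s =
    cong (_∧ all (λ u → 2 ≤ᵇ occ u ((p ∷ʳ t) ++ s)) (allFin K))
         (isYes-false (≡-dec _≟_ _ (allFin K)) incomplete)
    where
    open ≡-Reasoning
    incomplete : dedup ((p ∷ʳ t) ++ s) ≢ allFin K
    incomplete complete = t≢L (applyUpTo-++-∷ id L K (toℕ t) (map toℕ X) (begin
      upTo L ++ toℕ t ∷ map toℕ X            ≡⟨ cong (_++ toℕ t ∷ map toℕ X) (firsts inv) ⟨
      map toℕ (dedup p) ++ map toℕ (t ∷ X)  ≡⟨ map-++ toℕ (dedup p) (t ∷ X) ⟨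
      map toℕ (dedup p ++ t ∷ X)            ≡⟨ cong (map toℕ) (++-assoc (dedup p) [ t ] X) ⟨
      map toℕ ((dedup p ∷ʳ t) ++ X)         ≡⟨ cong (λ q → map toℕ (q ++ X)) (dedup-∷ʳ-new p t new) ⟨
      map toℕ (dedup (p ∷ʳ t) ++ X)         ≡⟨ cong (map toℕ) (trans (sym eq) complete) ⟩
      map toℕ (allFin K)                    ≡⟨ map-toℕ-allFin K ⟩
      upTo K                                ∎))

  unseen-rgs : ∀ {p L} → RGSPrefix p L → unseen (profile p) ≡ K ∸ L
  unseen-rgs {p} {L} inv = trans (sum-cong-≗ (cong 𝟙 ∘ unused inv)) (∑-≤toℕ K L)

  dedup-complete : ∀ {p L} → RGSPrefix p L → ⌊ ≡-dec _≟_ (dedup p) (allFin K) ⌋ ≡ (K ∸ L ≡ᵇ 0)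
  dedup-complete {p} {L} inv with L ≟ℕ K
  ... | yes refl = trans (isYes-true (≡-dec _≟_ (dedup p) (allFin L)) complete) (cong (_≡ᵇ 0) (sym (n∸n≡0 L)))
    where complete = map-injective toℕ-injective (trans (firsts inv) (sym (map-toℕ-allFin L)))
  ... | no  L≢K  = trans (isYes-false (≡-dec _≟_ (dedup p) (allFin K)) incomplete)
                         (cong (_≡ᵇ 0) (sym (+-∸-assoc 1 (≤∧≢⇒< (bound inv) L≢K))))
    where
    open ≡-Reasoning
    incomplete : dedup p ≢ allFin K
    incomplete complete = L≢K (begin
      L                            ≡⟨ length-upTo L ⟨
      length (upTo L)              ≡⟨ cong length (trans (sym (firsts inv)) (cong (map toℕ) complete)) ⟩
      length (map toℕ (allFin K))  ≡⟨ cong length (map-toℕ-allFin K) ⟩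
      length (upTo K)              ≡⟨ length-upTo K ⟩
      K                            ∎)

  isPartition≥2-rgs : ∀ {p L} → RGSPrefix p L → isPartition≥2 K p ≡ (K ∸ L ≡ᵇ 0) ∧ (singles (profile p) ≡ᵇ 0)
  isPartition≥2-rgs {p} {L} inv = begin
    ⌊ ≡-dec _≟_ (dedup p) (allFin K) ⌋ ∧ all (λ u → 2 ≤ᵇ occ u p) (allFin K)
      ≡⟨ cong₂ _∧_ (dedup-complete inv) (all-tabulate (λ u → 2 ≤ᵇ occ u p) (id {A = Fin K})) ⟩
    (K ∸ L ≡ᵇ 0) ∧ (typesWith (not ∘ (2 ≤ᵇ_)) p ≡ᵇ 0)
      ≡⟨ cong (λ n → (K ∸ L ≡ᵇ 0) ∧ (n ≡ᵇ 0)) (trans rare (cong (_+ singles (profile p)) (unseen-rgs inv))) ⟩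
    (K ∸ L ≡ᵇ 0) ∧ (K ∸ L + singles (profile p) ≡ᵇ 0)
      ≡⟨ bothZero (K ∸ L) (singles (profile p)) ⟩
    (K ∸ L ≡ᵇ 0) ∧ (singles (profile p) ≡ᵇ 0)
      ∎
    where
    open ≡-Reasoning
    atMostOnce : ∀ k → 𝟙 (not (2 ≤ᵇ k)) ≡ 𝟙 (k ≡ᵇ 0) + 𝟙 (k ≡ᵇ 1)
    atMostOnce zero          = refl
    atMostOnce (suc zero)    = refl
    atMostOnce (suc (suc k)) = refl
    rare : typesWith (not ∘ (2 ≤ᵇ_)) p ≡ unseen (profile p) + singles (profile p)
    rare = trans (sum-cong-≗ (λ u → atMostOnce (occ u p))) (∑-distrib-+ (λ u → 𝟙 (occ u p ≡ᵇ 0)) _)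
    bothZero : ∀ a b → (a ≡ᵇ 0) ∧ (a + b ≡ᵇ 0) ≡ (a ≡ᵇ 0) ∧ (b ≡ᵇ 0)
    bothZero zero    b = refl
    bothZero (suc a) b = refl

  ∑-nextLabel : ∀ {p L} → RGSPrefix p L → ∀ X →
    sum (λ u → 𝟙 (occ u p ≡ᵇ 0) * (𝟙 (toℕ u ≡ᵇ L) * X)) ≡ 𝟙 (L <ᵇ K) * X
  ∑-nextLabel {p} {L} inv X = begin
    sum {K} (λ u → 𝟙 (occ u p ≡ᵇ 0) * (𝟙 (toℕ u ≡ᵇ L) * X))  ≡⟨ sum-cong-≗ {K} onlyL ⟩
    sum {K} (λ u → 𝟙 (toℕ u ≡ᵇ L) * X)                      ≡⟨ *-distribʳ-sum X (𝟙 ∘ (_≡ᵇ L) ∘ toℕ {K}) ⟨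
    sum {K} (λ u → 𝟙 (toℕ u ≡ᵇ L)) * X                      ≡⟨ cong (_* X) (∑-toℕ≡ K L) ⟩
    𝟙 (L <ᵇ K) * X                                          ∎
    where
    open ≡-Reasoning
    onlyL : ∀ u → 𝟙 (occ u p ≡ᵇ 0) * (𝟙 (toℕ u ≡ᵇ L) * X) ≡ 𝟙 (toℕ u ≡ᵇ L) * X
    onlyL u with toℕ u ≟ℕ L
    ... | yes u≡L = trans (cong (λ β → 𝟙 β * (𝟙 (toℕ u ≡ᵇ L) * X)) unusedL) (*-identityˡ (𝟙 (toℕ u ≡ᵇ L) * X))
      where unusedL = trans (unused inv u) (dec-true (L ≤? toℕ u) (≤-reflexive (sym u≡L)))
    ... | no  u≢L rewrite dec-false (toℕ u ≟ℕ L) u≢L = *-zeroʳ (𝟙 (occ u p ≡ᵇ 0))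

  PartitionCounts : ℕ → Set
  PartitionCounts m = ∀ {p L} → RGSPrefix p L →
    count (λ s → isPartition≥2 K (p ++ s)) (draws K m)
      ≡ rgsCount m (suc (K ∸ L)) (singles (profile p)) (repeated (profile p))

  partitionCounts-∷ʳ : ∀ {m} → PartitionCounts m → ∀ {p L} → RGSPrefix p L → ∀ t →
    let b = singles (profile p) ; c = repeated (profile p) in
    count (λ s → isPartition≥2 K ((p ∷ʳ t) ++ s)) (draws K m)
      ≡ multiplicityCase (occ t p) (𝟙 (toℕ t ≡ᵇ L) * rgsCount m (K ∸ L) (suc b) c)
                                   (rgsCount m (suc (K ∸ L)) (b ∸ 1) (suc c)) (rgsCount m (suc (K ∸ L)) b c)
  partitionCounts-∷ʳ {m} counts {p} {L} inv t = byMultiplicity (occ t p) refl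
    where
    open ≡-Reasoning
    b = singles (profile p)
    c = repeated (profile p)
    X = rgsCount m (K ∸ L) (suc b) c
    Y = rgsCount m (suc (K ∸ L)) (b ∸ 1) (suc c)
    Z = rgsCount m (suc (K ∸ L)) b c
    P = λ s → isPartition≥2 K ((p ∷ʳ t) ++ s)
    R : ℕ → Profile → ℕ
    R a π = rgsCount m a (singles π) (repeated π)
    R-∷ʳ : ∀ a {k} → occ t p ≡ k → R a (profile (p ∷ʳ t)) ≡ R a (afterDrawing k (profile p))
    R-∷ʳ a refl = cong (R a) (profile-∷ʳ p t)
    seenAgain : ∀ k →
      R (suc (K ∸ L)) (afterDrawing (suc k) (profile p)) ≡ multiplicityCase (suc k) (𝟙 (toℕ t ≡ᵇ L) * X) Y Z
    seenAgain zero    = refl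
    seenAgain (suc k) = refl
    byMultiplicity : ∀ k → occ t p ≡ k → count P (draws K m) ≡ multiplicityCase k (𝟙 (toℕ t ≡ᵇ L) * X) Y Z
    byMultiplicity zero new with toℕ t ≟ℕ L
    ... | yes t≡L = begin
      count P (draws K m)                       ≡⟨ counts (rgs-new inv t new t≡L) ⟩
      R (suc (K ∸ suc L)) (profile (p ∷ʳ t))    ≡⟨ R-∷ʳ (suc (K ∸ suc L)) new ⟩
      rgsCount m (suc (K ∸ suc L)) (suc b) c    ≡⟨ cong (λ a → rgsCount m a (suc b) c) (+-∸-assoc 1 L<K) ⟨
      X                                         ≡⟨ *-identityˡ X ⟨
      1 * X                                     ≡⟨ cong (λ β → 𝟙 β * X) (dec-true (toℕ t ≟ℕ L) t≡L) ⟨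
      𝟙 (toℕ t ≡ᵇ L) * X                        ∎
      where L<K = subst (_< K) t≡L (toℕ<n t)
    ... | no  t≢L = begin
      count P (draws K m)                       ≡⟨ count-cong (rgs-skip inv t new t≢L) (draws K m) ⟩
      count (λ _ → false) (draws K m)           ≡⟨ count-false (draws K m) ⟩
      0                                         ≡⟨ cong (λ β → 𝟙 β * X) (dec-false (toℕ t ≟ℕ L) t≢L) ⟨
      𝟙 (toℕ t ≡ᵇ L) * X                        ∎
    byMultiplicity (suc k) seen = begin
      count P (draws K m)                                  ≡⟨ counts (rgs-seen inv t seen) ⟩
      R (suc (K ∸ L)) (profile (p ∷ʳ t))                   ≡⟨ R-∷ʳ (suc (K ∸ L)) seen ⟩
      R (suc (K ∸ L)) (afterDrawing (suc k) (profile p))   ≡⟨ seenAgain k ⟩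
      multiplicityCase (suc k) (𝟙 (toℕ t ≡ᵇ L) * X) Y Z    ∎

  count-partitions : ∀ m → PartitionCounts m
  count-partitions zero {p} {L} inv = begin
    count (λ s → isPartition≥2 K (p ++ s)) [ [] ]  ≡⟨ count-[] (λ s → isPartition≥2 K (p ++ s)) ⟩
    𝟙 (isPartition≥2 K (p ++ []))                  ≡⟨ cong (𝟙 ∘ isPartition≥2 K) (++-identityʳ p) ⟩
    𝟙 (isPartition≥2 K p)                          ≡⟨ cong 𝟙 (isPartition≥2-rgs inv) ⟩
    rgsCount 0 (suc (K ∸ L)) (singles (profile p)) (repeated (profile p)) ∎
    where open ≡-Reasoning
  count-partitions (suc m) {p} {L} inv = begin
    count (λ s → isPartition≥2 K (p ++ s)) (draws K (suc m))
      ≡⟨ count-extensions-suc K m (isPartition≥2 K) p ⟩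
    sum (λ t → count (λ s → isPartition≥2 K ((p ∷ʳ t) ++ s)) (draws K m))
      ≡⟨ sum-cong-≗ (partitionCounts-∷ʳ {m} (count-partitions m) inv) ⟩
    sum (λ t → multiplicityCase (occ t p) (𝟙 (toℕ t ≡ᵇ L) * X) Y Z)
      ≡⟨ ∑-multiplicityCase p (λ t → 𝟙 (toℕ t ≡ᵇ L) * X) Y Z ⟩
    sum (λ t → 𝟙 (occ t p ≡ᵇ 0) * (𝟙 (toℕ t ≡ᵇ L) * X)) + b * Y + c * Z
      ≡⟨ cong (λ n → n + b * Y + c * Z) (trans (∑-nextLabel inv X) (𝟙<ᵇ*rgsCount m K L (suc b) c)) ⟩
    X + b * Y + c * Z
      ∎
    where
    open ≡-Reasoning
    b = singles (profile p)
    c = repeated (profile p)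
    X = rgsCount m (K ∸ L) (suc b) c
    Y = rgsCount m (suc (K ∸ L)) (b ∸ 1) (suc c)
    Z = rgsCount m (suc (K ∸ L)) b c

-- The distribution of (T, J)

S≥2-rgsCount : ∀ m k → S≥2 (+ m) (+ k) ≡ rgsCount m (suc k) 0 0
S≥2-rgsCount m k =
  trans (count-partitions m (rgs-[] {k}))
        (cong (λ π → rgsCount m (suc k) (singles π) (repeated π)) (profile-[] {k}))

S≥2-⊖ : ∀ m d j → S≥2 (+ m) (d ⊖ suc j) ≡ rgsCount m (d ∸ j) 0 0
S≥2-⊖ m d j with suc j ≤? d
... | yes j<d = begin
  S≥2 (+ m) (d ⊖ suc j)             ≡⟨ cong (S≥2 (+ m)) (⊖-≥ j<d) ⟩
  S≥2 (+ m) (+ (d ∸ suc j))         ≡⟨ S≥2-rgsCount m (d ∸ suc j) ⟩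
  rgsCount m (suc (d ∸ suc j)) 0 0  ≡⟨ cong (λ a → rgsCount m a 0 0) (+-∸-assoc 1 j<d) ⟨
  rgsCount m (d ∸ j) 0 0            ∎
  where open ≡-Reasoning
... | no  j≮d = begin
  S≥2 (+ m) (d ⊖ suc j)             ≡⟨ cong (S≥2 (+ m)) (trans (⊖-< (≰⇒> j≮d)) (cong (-_ ∘ +_) (+-∸-assoc 1 d≤j))) ⟩
  S≥2 (+ m) -[1+ j ∸ d ]            ≡⟨⟩
  0                                 ≡⟨ rgsCount-dead m 0 0 ⟨
  rgsCount m 0 0 0                  ≡⟨ cong (λ a → rgsCount m a 0 0) (m≤n⇒m∸n≡0 d≤j) ⟨
  rgsCount m (d ∸ j) 0 0            ∎
  where
  open ≡-Reasoning
  d≤j = ≤-pred (≰⇒> j≮d)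

C*rgsCount≡C*S≥2 : ∀ n d j →
  (n C j) * rgsCount (n ∸ j) (d ∸ j) 0 0 ≡ (n C j) * S≥2 (+ suc n - + suc j) (+ d - + suc j)
C*rgsCount≡C*S≥2 n d j with j ≤? n
... | yes j≤n =
  cong (_*_ (n C j)) (sym (trans (cong (λ z → S≥2 z (d ⊖ suc j)) (⊖-≥ (s≤s j≤n))) (S≥2-⊖ (n ∸ j) d j)))
... | no  j≰n rewrite k>n⇒nCk≡0 (≰⇒> j≰n) = refl

count-eventTJ : ∀ d n j →
  count (eventTJ d (suc n) (suc j)) (draws d (suc n)) ≡ d ! * (n C j) * S≥2 (+ suc n - + suc j) (+ d - + suc j)
count-eventTJ d n j = begin
  count (eventTJ d (suc n) (suc j)) (draws d (suc n))        ≡⟨ count-completions {d} j (suc n) n [] refl ⟩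
  completions j n (profile {d} [])                            ≡⟨ cong (completions j n) (profile-[] {d}) ⟩
  completions j n ⟨ d , 0 , 0 ⟩                               ≡⟨ completions-splitCount j n d 0 0 ⟩
  d ! * splitCount n d j 0 0 0                                ≡⟨ cong (_*_ (d !)) (splitCount-rgsCount n d j 0 0) ⟩
  d ! * ((n C j) * rgsCount (n ∸ j) (d ∸ j) 0 0)              ≡⟨ cong (_*_ (d !)) (C*rgsCount≡C*S≥2 n d j) ⟩
  d ! * ((n C j) * S≥2 (+ suc n - + suc j) (+ d - + suc j))   ≡⟨ *-assoc (d !) (n C j) _ ⟨
  d ! * (n C j) * S≥2 (+ suc n - + suc j) (+ d - + suc j)     ∎
  where open ≡-Reasoning

mainTheorem8 : (d : ℕ) → .{{_ : NonZero d}} → (n j : ℕ) → n ≥ 1 → j ≥ 1 →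
    probTJ d n j ≡ _/_ (+ (d ! * ((n ∸ 1) C (j ∸ 1)) * S≥2 (+ n - + j) (+ d - + j))) (d ^ n) {{m^n≢0 d n}}
mainTheorem8 d (suc n) (suc j) _ _ =
  cong (λ k → _/_ (+ k) (d ^ suc n) {{m^n≢0 d (suc n)}}) (count-eventTJ d n j)
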